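{- Let $x_0=(y_0,m_0,d_0)\in G_0$ and let $r_1=\#\{z\in G_0: (100\cdot(y_0/100),3,0)\le z<x_0\}$ be its day of the century. Set $n_2=4\cdot r_1+3$, $q_2=n_2/1461$ and $r_2=n_2\%1461/4$. Then $q_2=y_0\%100$ (the year of the century of $x_0$) and $r_2=\#\{z\in G_0: (y_0,3,0)\le z<x_0\}$ (the day of the year of $x_0$).
   Context: For $n,\delta\in\mathbb{Z}$ with $\delta\neq0$, $n/\delta$ and $n\%\delta$ denote Euclidean quotient and remainder ($n=q\delta+s$, $0\le s<|\delta|$); $\cdot$, $/$, $\%$ have equal precedence and associate left to right. $\mathbb{Z}^3$ carries the lexicographic order. A year $y$ is a leap year if ($y\%4=0$ and $y\%100\ne0$) or $y\%400=0$. The Gregorian calendar is $G=\{(y,m,d)\in\mathbb{Z}^3: m\in\{1,\dots,12\},\ 1\le d\le L(y,m)\}$ where $L(y,m)=31$ for $m\in\{1,3,5,7,8,10,12\}$, $L(y,m)=30$ for $m\in\{4,6,9,11\}$, and $L(y,2)=29$ if $y$ is a leap year and $28$ otherwise. Let $P_1:\mathbb{Z}^3\to\mathbb{Z}^3$, $P_1(y,m,d)=(y-\mathbf 1_{\{m\le2\}},\ m+12\cdot\mathbf 1_{\{m\le2\}},\ d-1)$, where $\mathbf 1_{\{P\}}$ is $1$ if $P$ holds and $0$ otherwise. The computational calendar is $G_0=\{P_1(x): x\in G,\ P_1(x)\ge (0,3,0)\}$. -}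

module Defs where

open import Data.Bool using (Bool; true; false; _∧_; _∨_; not; if_then_else_)
open import Data.Nat as ℕ using (ℕ; _≡ᵇ_)
open import Data.Integer using (ℤ; +_; _+_; _-_; _*_; _≤_; _<_; _%ℕ_; _/ℕ_)
open import Data.Product using (Σ; _×_; _,_)
open import Data.Sum using (_⊎_)
open import Relation.Binary.PropositionalEquality using (_≡_)

ℤ³ : Set
ℤ³ = ℤ × ℤ × ℤ

_<ₗ_ : ℤ³ → ℤ³ → Set
(y , m , d) <ₗ (y′ , m′ , d′) =
  (y < y′) ⊎ ((y ≡ y′) × (m < m′)) ⊎ ((y ≡ y′) × (m ≡ m′) × (d < d′))

_≤ₗ_ : ℤ³ → ℤ³ → Set
a ≤ₗ b = (a <ₗ b) ⊎ (a ≡ b)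

isLeap : ℤ → Bool
isLeap y = ((y %ℕ 4 ≡ᵇ 0) ∧ not (y %ℕ 100 ≡ᵇ 0)) ∨ (y %ℕ 400 ≡ᵇ 0)

-- Month lengths L(y, m); the value for m ∉ {1..12} is irrelevant (such m are excluded from G)
L : ℤ → ℤ → ℤ
L y (+ 1)  = + 31
L y (+ 2)  = if isLeap y then + 29 else + 28
L y (+ 3)  = + 31
L y (+ 4)  = + 30
L y (+ 5)  = + 31
L y (+ 6)  = + 30
L y (+ 7)  = + 31
L y (+ 8)  = + 31
L y (+ 9)  = + 30
L y (+ 10) = + 31
L y (+ 11) = + 30
L y (+ 12) = + 31
L y _      = + 0

InG : ℤ³ → Set
InG (y , m , d) = (+ 1 ≤ m) × (m ≤ + 12) × (+ 1 ≤ d) × (d ≤ L y m)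

𝟙≤2 : ℤ → ℤ
𝟙≤2 m = if m Data.Integer.≤ᵇ + 2 then + 1 else + 0

P₁ : ℤ³ → ℤ³
P₁ (y , m , d) = (y - 𝟙≤2 m , m + + 12 * 𝟙≤2 m , d - + 1)

InG₀ : ℤ³ → Set
InG₀ z = Σ ℤ³ (λ x → InG x × (P₁ x ≡ z) × ((+ 0 , + 3 , + 0) ≤ₗ P₁ x))

G₀Interval : ℤ³ → ℤ³ → Set
G₀Interval a b = Σ ℤ³ (λ z → InG₀ z × (a ≤ₗ z) × (z <ₗ b))

-- Read G₀ as natural-number triples (y, m, d) with months 3 to 14. The day number of such a
-- date (days since (0, 3, 0)) is strictly monotone for the lexicographic order and takes every
-- value, so an interval of G₀ has as many elements as the difference of the day numbers of its
-- ends. Writing y₀ = 100 c + j, this makes r₁ = ⌊1461 j / 4⌋ + r₂ with r₂ the day of the year: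
-- inside a century only the 4-year rule acts, except on the February closing year j = 99.
-- As r₂ stays below the length of year j, the claim is the inversion formula for the
-- Euclidean affine function j ↦ ⌊1461 j / 4⌋.

module Submission where

open import Defs
open import Data.Bool using (true; false; if_then_else_)
open import Data.Bool.Properties using (∧-identityʳ; ∨-identityʳ)
open import Data.Empty using (⊥-elim)
open import Data.Fin using (Fin; toℕ; fromℕ<)
open import Data.Fin.Permutation using (↔⇒≡)
import Data.Fin.Properties as Finₚ
open import Data.Nat using (ℕ; zero; suc; _+_; _*_; _∸_; _/_; _%_; _≤_; _<_; _≤ᵇ_; _≡ᵇ_; z≤n; s≤s; s≤s⁻¹; _<?_; _≟_; NonZero)
open import Data.Nat.Properties
open import Data.Nat.DivMod
open import Data.Nat.Divisibility using (divides; divides-refl)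
open import Data.Nat.Tactic.RingSolver using (solve-∀)
open import Data.Integer as ℤ using (ℤ; +_; +≤+; +<+; _%ℕ_; _/ℕ_) renaming (_*_ to _*ℤ_)
import Data.Integer.Properties as ℤ
open import Data.Product using (Σ-syntax; _×_; _,_; proj₁; proj₂)
open import Data.Sum using (_⊎_; inj₁; inj₂; [_,_]′)
open import Function.Bundles using (_↔_; mk↔ₛ′)
open import Function.Properties.Inverse using (↔-trans; ↔-sym)
open import Relation.Binary.Definitions using (tri<; tri≈; tri>)
open import Relation.Binary.PropositionalEquality
open import Relation.Nullary using (¬_; yes; no)
open import Relation.Nullary.Decidable using (from-yes)

-- Sums, counting and division

sumBelow : (ℕ → ℕ) → ℕ → ℕ
sumBelow f zero    = 0
sumBelow f (suc n) = sumBelow f n + f n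

sumBelow-mono-≤ : ∀ f {m n} → m ≤ n → sumBelow f m ≤ sumBelow f n
sumBelow-mono-≤ f {n = zero}  z≤n = ≤-refl
sumBelow-mono-≤ f {m} {suc n} m≤1+n with m≤n⇒m<n∨m≡n m≤1+n
... | inj₁ (s≤s m≤n) = ≤-trans (sumBelow-mono-≤ f m≤n) (m≤m+n (sumBelow f n) (f n))
... | inj₂ refl      = ≤-refl

Fin↔-of-rank : ∀ {A : Set} (rank : A → ℕ) {lo hi : ℕ}
  → (∀ a → lo ≤ rank a × rank a < hi)
  → (∀ {a a′} → rank a ≡ rank a′ → a ≡ a′)
  → (∀ {n} → lo ≤ n → n < hi → Σ[ a ∈ A ] rank a ≡ n)
  → Fin (hi ∸ lo) ↔ A
Fin↔-of-rank {A} rank {lo} {hi} bounds injective surjective = mk↔ₛ′ to from to∘from from∘to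
  where
  lo≤hi : Fin (hi ∸ lo) → lo ≤ hi
  lo≤hi i with ≤-total lo hi
  ... | inj₁ lo≤hi = lo≤hi
  ... | inj₂ hi≤lo = ⊥-elim (<⇒≱ (subst (toℕ i <_) (m≤n⇒m∸n≡0 hi≤lo) (Finₚ.toℕ<n i)) z≤n)

  shifted<hi : (i : Fin (hi ∸ lo)) → lo + toℕ i < hi
  shifted<hi i = subst (lo + toℕ i <_) (m+[n∸m]≡n (lo≤hi i)) (+-monoʳ-< lo (Finₚ.toℕ<n i))

  to : Fin (hi ∸ lo) → A
  to i = proj₁ (surjective (m≤m+n lo (toℕ i)) (shifted<hi i))

  offset<width : ∀ a → rank a ∸ lo < hi ∸ lo
  offset<width a = ∸-monoˡ-< (proj₂ (bounds a)) (proj₁ (bounds a))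

  from : A → Fin (hi ∸ lo)
  from a = fromℕ< (offset<width a)

  to∘from : ∀ a → to (from a) ≡ a
  to∘from a = injective (begin
    rank (to (from a))             ≡⟨ proj₂ (surjective _ (shifted<hi (from a))) ⟩
    lo + toℕ (from a)              ≡⟨ cong (_+_ lo) (Finₚ.toℕ-fromℕ< (offset<width a)) ⟩
    lo + (rank a ∸ lo)             ≡⟨ m+[n∸m]≡n (proj₁ (bounds a)) ⟩
    rank a                         ∎)
    where open ≡-Reasoning

  from∘to : ∀ i → from (to i) ≡ i
  from∘to i = Finₚ.toℕ-injective (begin
    toℕ (from (to i))              ≡⟨ Finₚ.toℕ-fromℕ< (offset<width (to i)) ⟩
    rank (to i) ∸ lo               ≡⟨ cong (_∸ lo) (proj₂ (surjective (m≤m+n lo (toℕ i)) (shifted<hi i))) ⟩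
    lo + toℕ i ∸ lo                ≡⟨ m+n∸m≡n lo (toℕ i) ⟩
    toℕ i                          ∎)
    where open ≡-Reasoning

[r+qn]/n≡q : ∀ r q n .{{_ : NonZero n}} → r < n → (r + q * n) / n ≡ q
[r+qn]/n≡q r q n r<n = trans (+-distrib-/-∣ʳ r (divides-refl q)) (cong₂ _+_ (m<n⇒m/n≡0 r<n) (m*n/n≡m q n))

[r+qn]%n≡r : ∀ r q n .{{_ : NonZero n}} → r < n → (r + q * n) % n ≡ r
[r+qn]%n≡r r q n r<n = trans ([m+kn]%n≡m%n r q n) (m<n⇒m%n≡m r<n)

floor-affine-inverse : ∀ a b .{{_ : NonZero a}} .{{_ : NonZero b}} j r → a * j / b + r < a * suc j / b
  → (b * (a * j / b + r) + (b ∸ 1)) / a ≡ j × (b * (a * j / b + r) + (b ∸ 1)) % a / b ≡ r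
floor-affine-inverse a b@(suc k) j r below-next =
  trans (/-congˡ n≡t+ja) ([r+qn]/n≡q t j a t<a) , remainder
  where
  -- n = t + j a with t < a, and t = r b + c with c < b.
  f = a * j / b
  s = a * j % b
  c = k ∸ s
  t = r * b + c
  n = b * (f + r) + k

  c+s≡k : c + s ≡ k
  c+s≡k = m∸n+n≡m (s≤s⁻¹ (m%n<n (a * j) b))

  suc-r*b≤a+s : suc r * b ≤ a + s
  suc-r*b≤a+s = +-cancelʳ-≤ (f * b) (suc r * b) (a + s) (begin
    suc r * b + f * b   ≡⟨ lemma r f b ⟩
    suc (f + r) * b     ≤⟨ *-monoˡ-≤ b below-next ⟩
    a * suc j / b * b   ≤⟨ m/n*n≤m (a * suc j) b ⟩
    a * suc j           ≡⟨ *-suc a j ⟩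
    a + a * j           ≡⟨ cong (_+_ a) (m≡m%n+[m/n]*n (a * j) b) ⟩
    a + (s + f * b)     ≡⟨ +-assoc a s (f * b) ⟨
    a + s + f * b       ∎)
    where
    open ≤-Reasoning
    lemma : ∀ r f b → suc r * b + f * b ≡ suc (f + r) * b
    lemma = solve-∀

  t<a : t < a
  t<a = +-cancelʳ-≤ s (suc t) a (begin
    suc t + s              ≡⟨ lemma r b c s ⟩
    suc (r * b + (c + s))  ≡⟨ cong (λ x → suc (r * b + x)) c+s≡k ⟩
    suc (r * b + k)        ≡⟨ cong suc (+-comm (r * b) k) ⟩
    suc r * b              ≤⟨ suc-r*b≤a+s ⟩
    a + s                  ∎)
    where
    open ≤-Reasoning
    lemma : ∀ r b c s → suc (r * b + c) + s ≡ suc (r * b + (c + s))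
    lemma = solve-∀

  n≡t+ja : n ≡ t + j * a
  n≡t+ja = begin
    b * (f + r) + k          ≡⟨ cong (_+_ (b * (f + r))) c+s≡k ⟨
    b * (f + r) + (c + s)    ≡⟨ lemma b f r c s ⟩
    (s + f * b) + t          ≡⟨ cong (_+ t) (m≡m%n+[m/n]*n (a * j) b) ⟨
    a * j + t                ≡⟨ lemma₂ a j t ⟩
    t + j * a                ∎
    where
    open ≡-Reasoning
    lemma : ∀ b f r c s → b * (f + r) + (c + s) ≡ (s + f * b) + (r * b + c)
    lemma = solve-∀
    lemma₂ : ∀ a j t → a * j + t ≡ t + j * a
    lemma₂ = solve-∀

  remainder : n % a / b ≡ r
  remainder = begin
    n % a / b          ≡⟨ /-congˡ (trans (%-congˡ n≡t+ja) ([r+qn]%n≡r t j a t<a)) ⟩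
    (r * b + c) / b    ≡⟨ /-congˡ (+-comm (r * b) c) ⟩
    (c + r * b) / b    ≡⟨ [r+qn]/n≡q c r b (s≤s (m∸n≤m k s)) ⟩
    r                  ∎
    where open ≡-Reasoning

-- Dates with natural-number coordinates

Date : Set
Date = ℕ × ℕ × ℕ

toℤ³ : Date → ℤ³
toℤ³ (y , m , d) = + y , + m , + d

-- Months run from 3 (March) to 14 (February of year y + 1), as in G₀; the
-- length is 0 outside this range, so IsDate below also bounds the month.
monthLength : ℕ → ℕ → ℕ
monthLength y 3  = 31
monthLength y 4  = 30
monthLength y 5  = 31
monthLength y 6  = 30
monthLength y 7  = 31
monthLength y 8  = 31
monthLength y 9  = 30
monthLength y 10 = 31
monthLength y 11 = 30
monthLength y 12 = 31
monthLength y 13 = 31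
monthLength y 14 = if isLeap (+ suc y) then 29 else 28
monthLength y _  = 0

daysBeforeMonth : ℕ → ℕ → ℕ
daysBeforeMonth y = sumBelow (monthLength y)

yearLength : ℕ → ℕ
yearLength y = daysBeforeMonth y 15

daysBeforeYear : ℕ → ℕ
daysBeforeYear = sumBelow yearLength

dayOfYear : ℕ → ℕ → ℕ → ℕ
dayOfYear y m d = daysBeforeMonth y m + d

dayNumber : Date → ℕ
dayNumber (y , m , d) = daysBeforeYear y + dayOfYear y m d

IsDate : Date → Set
IsDate (y , m , d) = d < monthLength y m

pattern 15+ k = suc (suc (suc (suc (suc (suc (suc (suc (suc (suc (suc (suc (suc (suc (suc k))))))))))))))

month-range : ∀ y m {d} → d < monthLength y m → 3 ≤ m × m ≤ 14
month-range y 0  ()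
month-range y 1  ()
month-range y 2  ()
month-range y 3  _ = ≤ᵇ⇒≤ 3 3 _ , ≤ᵇ⇒≤ 3 14 _
month-range y 4  _ = ≤ᵇ⇒≤ 3 4 _ , ≤ᵇ⇒≤ 4 14 _
month-range y 5  _ = ≤ᵇ⇒≤ 3 5 _ , ≤ᵇ⇒≤ 5 14 _
month-range y 6  _ = ≤ᵇ⇒≤ 3 6 _ , ≤ᵇ⇒≤ 6 14 _
month-range y 7  _ = ≤ᵇ⇒≤ 3 7 _ , ≤ᵇ⇒≤ 7 14 _
month-range y 8  _ = ≤ᵇ⇒≤ 3 8 _ , ≤ᵇ⇒≤ 8 14 _
month-range y 9  _ = ≤ᵇ⇒≤ 3 9 _ , ≤ᵇ⇒≤ 9 14 _
month-range y 10 _ = ≤ᵇ⇒≤ 3 10 _ , ≤ᵇ⇒≤ 10 14 _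
month-range y 11 _ = ≤ᵇ⇒≤ 3 11 _ , ≤ᵇ⇒≤ 11 14 _
month-range y 12 _ = ≤ᵇ⇒≤ 3 12 _ , ≤ᵇ⇒≤ 12 14 _
month-range y 13 _ = ≤ᵇ⇒≤ 3 13 _ , ≤ᵇ⇒≤ 13 14 _
month-range y 14 _ = ≤ᵇ⇒≤ 3 14 _ , ≤ᵇ⇒≤ 14 14 _
month-range y (15+ k) ()

monthLength-pos : ∀ y m → 3 ≤ m → m ≤ 14 → 0 < monthLength y m
monthLength-pos y 1 (s≤s ()) _
monthLength-pos y 2 (s≤s (s≤s ())) _
monthLength-pos y 3  _ _ = s≤s z≤n
monthLength-pos y 4  _ _ = s≤s z≤n
monthLength-pos y 5  _ _ = s≤s z≤n
monthLength-pos y 6  _ _ = s≤s z≤n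
monthLength-pos y 7  _ _ = s≤s z≤n
monthLength-pos y 8  _ _ = s≤s z≤n
monthLength-pos y 9  _ _ = s≤s z≤n
monthLength-pos y 10 _ _ = s≤s z≤n
monthLength-pos y 11 _ _ = s≤s z≤n
monthLength-pos y 12 _ _ = s≤s z≤n
monthLength-pos y 13 _ _ = s≤s z≤n
monthLength-pos y 14 _ _ with isLeap (+ suc y)
... | true  = s≤s z≤n
... | false = s≤s z≤n
monthLength-pos y (15+ k) _ k+15≤14 = ⊥-elim (<-irrefl refl (≤-trans (m≤m+n 15 k) k+15≤14))

dayOfYear<yearLength : ∀ {y m d} → IsDate (y , m , d) → dayOfYear y m d < yearLength y
dayOfYear<yearLength {y} {m} {d} v =
  <-≤-trans (+-monoʳ-< (daysBeforeMonth y m) v) (sumBelow-mono-≤ (monthLength y) (s≤s (proj₂ (month-range y m v))))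

dayNumber-mono : ∀ t t′ → IsDate t → toℤ³ t <ₗ toℤ³ t′ → dayNumber t < dayNumber t′
dayNumber-mono (y , m , d) (y′ , m′ , d′) v (inj₁ (+<+ y<y′)) = begin-strict
  daysBeforeYear y + dayOfYear y m d  <⟨ +-monoʳ-< (daysBeforeYear y) (dayOfYear<yearLength {y} {m} {d} v) ⟩
  daysBeforeYear (suc y)              ≤⟨ sumBelow-mono-≤ yearLength {suc y} {y′} y<y′ ⟩
  daysBeforeYear y′                   ≤⟨ m≤m+n (daysBeforeYear y′) (dayOfYear y′ m′ d′) ⟩
  dayNumber (y′ , m′ , d′)            ∎
  where open ≤-Reasoning
dayNumber-mono (y , m , d) (_ , m′ , d′) v (inj₂ (inj₁ (refl , +<+ m<m′))) =
  +-monoʳ-< (daysBeforeYear y) (begin-strict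
    daysBeforeMonth y m + d    <⟨ +-monoʳ-< (daysBeforeMonth y m) v ⟩
    daysBeforeMonth y (suc m)  ≤⟨ sumBelow-mono-≤ (monthLength y) m<m′ ⟩
    daysBeforeMonth y m′       ≤⟨ m≤m+n (daysBeforeMonth y m′) d′ ⟩
    daysBeforeMonth y m′ + d′  ∎)
  where open ≤-Reasoning
dayNumber-mono (y , m , d) _ v (inj₂ (inj₂ (refl , refl , +<+ d<d′))) =
  +-monoʳ-< (daysBeforeYear y) (+-monoʳ-< (daysBeforeMonth y m) d<d′)

date-trichotomy : ∀ t t′ → toℤ³ t <ₗ toℤ³ t′ ⊎ t ≡ t′ ⊎ toℤ³ t′ <ₗ toℤ³ t
date-trichotomy (y , m , d) (y′ , m′ , d′) with <-cmp y y′
... | tri< y<y′ _ _ = inj₁ (inj₁ (+<+ y<y′))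
... | tri> _ _ y>y′ = inj₂ (inj₂ (inj₁ (+<+ y>y′)))
... | tri≈ _ refl _ with <-cmp m m′
...   | tri< m<m′ _ _ = inj₁ (inj₂ (inj₁ (refl , +<+ m<m′)))
...   | tri> _ _ m>m′ = inj₂ (inj₂ (inj₂ (inj₁ (refl , +<+ m>m′))))
...   | tri≈ _ refl _ with <-cmp d d′
...     | tri< d<d′ _ _ = inj₁ (inj₂ (inj₂ (refl , refl , +<+ d<d′)))
...     | tri> _ _ d>d′ = inj₂ (inj₂ (inj₂ (inj₂ (refl , refl , +<+ d>d′))))
...     | tri≈ _ refl _ = inj₂ (inj₁ refl)

module _ {t t′ : Date} (v : IsDate t) (v′ : IsDate t′) where

  dayNumber-reflects-< : dayNumber t < dayNumber t′ → toℤ³ t <ₗ toℤ³ t′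
  dayNumber-reflects-< n<n′ with date-trichotomy t t′
  ... | inj₁ t<t′        = t<t′
  ... | inj₂ (inj₁ refl) = ⊥-elim (<-irrefl refl n<n′)
  ... | inj₂ (inj₂ t′<t) = ⊥-elim (<-asym n<n′ (dayNumber-mono t′ t v′ t′<t))

  dayNumber-reflects-≤ : dayNumber t ≤ dayNumber t′ → toℤ³ t ≤ₗ toℤ³ t′
  dayNumber-reflects-≤ n≤n′ with date-trichotomy t t′
  ... | inj₁ t<t′        = inj₁ t<t′
  ... | inj₂ (inj₁ refl) = inj₂ refl
  ... | inj₂ (inj₂ t′<t) = ⊥-elim (<⇒≱ (dayNumber-mono t′ t v′ t′<t) n≤n′)

  dayNumber-injective : dayNumber t ≡ dayNumber t′ → t ≡ t′
  dayNumber-injective n≡n′ with date-trichotomy t t′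
  ... | inj₁ t<t′        = ⊥-elim (<-irrefl n≡n′ (dayNumber-mono t t′ v t<t′))
  ... | inj₂ (inj₁ t≡t′) = t≡t′
  ... | inj₂ (inj₂ t′<t) = ⊥-elim (<-irrefl (sym n≡n′) (dayNumber-mono t′ t v′ t′<t))

monthEnd-dayNumber : ∀ y m d → suc d ≡ monthLength y m → suc (dayNumber (y , m , d)) ≡ daysBeforeYear y + daysBeforeMonth y (suc m)
monthEnd-dayNumber y m d d+1≡len = begin
  suc (daysBeforeYear y + (daysBeforeMonth y m + d))  ≡⟨ +-suc (daysBeforeYear y) (dayOfYear y m d) ⟨
  daysBeforeYear y + suc (daysBeforeMonth y m + d)    ≡⟨ cong (_+_ (daysBeforeYear y)) (+-suc (daysBeforeMonth y m) d) ⟨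
  daysBeforeYear y + (daysBeforeMonth y m + suc d)    ≡⟨ cong (λ n → daysBeforeYear y + (daysBeforeMonth y m + n)) d+1≡len ⟩
  daysBeforeYear y + daysBeforeMonth y (suc m)        ∎
  where open ≡-Reasoning

firstDayOfNextMonth : ∀ y m d → IsDate (y , m , d) → suc d ≡ monthLength y m
  → Σ[ t′ ∈ Date ] IsDate t′ × dayNumber t′ ≡ suc (dayNumber (y , m , d))
firstDayOfNextMonth y m d v d+1≡len with m <? 14
... | yes m<14 =
  (y , suc m , 0) , monthLength-pos y (suc m) (m≤n⇒m≤1+n (proj₁ (month-range y m v))) m<14 ,
  trans (cong (_+_ (daysBeforeYear y)) (+-identityʳ (daysBeforeMonth y (suc m)))) (sym (monthEnd-dayNumber y m d d+1≡len))
... | no m≮14 with ≤-antisym (proj₂ (month-range y m v)) (≮⇒≥ m≮14)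
...   | refl = (suc y , 3 , 0) , s≤s z≤n , trans (+-identityʳ (daysBeforeYear (suc y))) (sym (monthEnd-dayNumber y 14 d d+1≡len))

nextDay : ∀ t → IsDate t → Σ[ t′ ∈ Date ] IsDate t′ × dayNumber t′ ≡ suc (dayNumber t)
nextDay (y , m , d) v with suc d <? monthLength y m
... | yes d+1<len =
  (y , m , suc d) , d+1<len ,
  trans (cong (_+_ (daysBeforeYear y)) (+-suc (daysBeforeMonth y m) d)) (+-suc (daysBeforeYear y) (dayOfYear y m d))
... | no d+1≮len = firstDayOfNextMonth y m d v (≤-antisym v (≮⇒≥ d+1≮len))

dayNumber-surjective : ∀ n → Σ[ t ∈ Date ] IsDate t × dayNumber t ≡ n
dayNumber-surjective zero = (0 , 3 , 0) , s≤s z≤n , refl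
dayNumber-surjective (suc n) with dayNumber-surjective n
... | t , v , refl = nextDay t v

-- G₀ as the set of natural-number dates

toℤ³-injective : ∀ {t t′} → toℤ³ t ≡ toℤ³ t′ → t ≡ t′
toℤ³-injective {_ , _ , _} {_ , _ , _} refl = refl

P₁⁻¹ : Date → ℤ³
P₁⁻¹ (y , m , d) = if m ≤ᵇ 12 then (+ y , + m , + suc d) else (+ suc y , + (m ∸ 12) , + suc d)

G₀View : ℤ³ → ℤ³ → Set
G₀View x z = Σ[ t ∈ Date ] IsDate t × toℤ³ t ≡ z × x ≡ P₁⁻¹ t

pattern 13+ k = suc (suc (suc (suc (suc (suc (suc (suc (suc (suc (suc (suc (suc k))))))))))))

L-MarchToDecember : ∀ y m → 3 ≤ m → m ≤ 12 → L (+ y) (+ m) ≡ + monthLength y m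
L-MarchToDecember y 1 (s≤s ()) _
L-MarchToDecember y 2 (s≤s (s≤s ())) _
L-MarchToDecember y 3  _ _ = refl
L-MarchToDecember y 4  _ _ = refl
L-MarchToDecember y 5  _ _ = refl
L-MarchToDecember y 6  _ _ = refl
L-MarchToDecember y 7  _ _ = refl
L-MarchToDecember y 8  _ _ = refl
L-MarchToDecember y 9  _ _ = refl
L-MarchToDecember y 10 _ _ = refl
L-MarchToDecember y 11 _ _ = refl
L-MarchToDecember y 12 _ _ = refl
L-MarchToDecember y (13+ k) _ k+13≤12 = ⊥-elim (<-irrefl refl (≤-trans (m≤m+n 13 k) k+13≤12))

L-February : ∀ y → L (+ suc y) (+ 2) ≡ + monthLength y 14
L-February y with isLeap (+ suc y)
... | true  = refl
... | false = refl

P₁-MarchToDecember : ∀ y m d → 3 ≤ m → P₁ (+ y , + m , + suc d) ≡ toℤ³ (y , m , d)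
P₁-MarchToDecember y m d (s≤s (s≤s (s≤s _))) =
  cong₂ (λ y′ m′ → y′ , m′ , + d) (ℤ.+-identityʳ (+ y)) (ℤ.+-identityʳ (+ m))

P₁⁻¹-MarchToDecember : ∀ y m d → m ≤ 12 → P₁⁻¹ (y , m , d) ≡ (+ y , + m , + suc d)
P₁⁻¹-MarchToDecember y m d m≤12 with m ≤ᵇ 12 | ≤⇒≤ᵇ m≤12
... | true | _ = refl

origin≤ : ∀ y m d → 3 ≤ m → (+ 0 , + 3 , + 0) ≤ₗ toℤ³ (y , m , d)
origin≤ (suc y) m d _ = inj₁ (inj₁ (+<+ (s≤s z≤n)))
origin≤ 0 1 d (s≤s ())
origin≤ 0 2 d (s≤s (s≤s ()))
origin≤ 0 3 0 _ = inj₂ refl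
origin≤ 0 3 (suc d) _ = inj₁ (inj₂ (inj₂ (refl , refl , +<+ (s≤s z≤n))))
origin≤ 0 (suc (suc (suc (suc m)))) d _ = inj₁ (inj₂ (inj₁ (refl , +<+ (s≤s (s≤s (s≤s (s≤s z≤n)))))))

P₁-view : ∀ x → InG x → + 0 ℤ.≤ proj₁ (P₁ x) → G₀View x (P₁ x)
P₁-view (Y , + 0 , D) (+≤+ () , _) _
P₁-view (Y , + suc m , + 0) (_ , _ , +≤+ () , _) _
P₁-view (+ suc y , + 1 , + suc d) (_ , _ , _ , d<len) _ = (y , 13 , d) , ℤ.drop‿+≤+ d<len , refl , refl
P₁-view (+ suc y , + 2 , + suc d) (_ , _ , _ , d<len) _ =
  (y , 14 , d) , ℤ.drop‿+≤+ (subst (+ suc d ℤ.≤_) (L-February y) d<len) , refl , refl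
P₁-view (+ y , + m@(suc (suc (suc _))) , + suc d) (_ , +≤+ m≤12 , _ , d<len) _ =
  (y , m , d) , ℤ.drop‿+≤+ (subst (+ suc d ℤ.≤_) (L-MarchToDecember y m 3≤m m≤12) d<len) ,
  sym (P₁-MarchToDecember y m d 3≤m) , sym (P₁⁻¹-MarchToDecember y m d m≤12)
  where
  3≤m : 3 ≤ m
  3≤m = s≤s (s≤s (s≤s z≤n))

year-nonneg : ∀ {z} → (+ 0 , + 3 , + 0) ≤ₗ z → + 0 ℤ.≤ proj₁ z
year-nonneg (inj₁ (inj₁ 0<y))             = ℤ.<⇒≤ 0<y
year-nonneg (inj₁ (inj₂ (inj₁ (refl , _)))) = ℤ.≤-refl
year-nonneg (inj₁ (inj₂ (inj₂ (refl , _)))) = ℤ.≤-refl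
year-nonneg (inj₂ refl)                   = ℤ.≤-refl

InG₀⇒view : ∀ {z} (p : InG₀ z) → G₀View (proj₁ p) z
InG₀⇒view (x , x∈G , refl , origin≤P₁x) = P₁-view x x∈G (year-nonneg origin≤P₁x)

MarchToDecember⇒InG₀ : ∀ y m d → 3 ≤ m → m ≤ 12 → d < monthLength y m → InG₀ (toℤ³ (y , m , d))
MarchToDecember⇒InG₀ y m d 3≤m m≤12 v =
  (+ y , + m , + suc d) ,
  (+≤+ (≤-trans (s≤s z≤n) 3≤m) , +≤+ m≤12 , +≤+ (s≤s z≤n) ,
   subst (+ suc d ℤ.≤_) (sym (L-MarchToDecember y m 3≤m m≤12)) (+≤+ v)) ,
  P₁-MarchToDecember y m d 3≤m ,
  subst ((+ 0 , + 3 , + 0) ≤ₗ_) (sym (P₁-MarchToDecember y m d 3≤m)) (origin≤ y m d 3≤m)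

IsDate⇒InG₀ : ∀ t → IsDate t → InG₀ (toℤ³ t)
IsDate⇒InG₀ (y , 3  , d) = MarchToDecember⇒InG₀ y 3  d (≤ᵇ⇒≤ 3 3  _) (≤ᵇ⇒≤ 3  12 _)
IsDate⇒InG₀ (y , 4  , d) = MarchToDecember⇒InG₀ y 4  d (≤ᵇ⇒≤ 3 4  _) (≤ᵇ⇒≤ 4  12 _)
IsDate⇒InG₀ (y , 5  , d) = MarchToDecember⇒InG₀ y 5  d (≤ᵇ⇒≤ 3 5  _) (≤ᵇ⇒≤ 5  12 _)
IsDate⇒InG₀ (y , 6  , d) = MarchToDecember⇒InG₀ y 6  d (≤ᵇ⇒≤ 3 6  _) (≤ᵇ⇒≤ 6  12 _)
IsDate⇒InG₀ (y , 7  , d) = MarchToDecember⇒InG₀ y 7  d (≤ᵇ⇒≤ 3 7  _) (≤ᵇ⇒≤ 7  12 _)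
IsDate⇒InG₀ (y , 8  , d) = MarchToDecember⇒InG₀ y 8  d (≤ᵇ⇒≤ 3 8  _) (≤ᵇ⇒≤ 8  12 _)
IsDate⇒InG₀ (y , 9  , d) = MarchToDecember⇒InG₀ y 9  d (≤ᵇ⇒≤ 3 9  _) (≤ᵇ⇒≤ 9  12 _)
IsDate⇒InG₀ (y , 10 , d) = MarchToDecember⇒InG₀ y 10 d (≤ᵇ⇒≤ 3 10 _) (≤ᵇ⇒≤ 10 12 _)
IsDate⇒InG₀ (y , 11 , d) = MarchToDecember⇒InG₀ y 11 d (≤ᵇ⇒≤ 3 11 _) (≤ᵇ⇒≤ 11 12 _)
IsDate⇒InG₀ (y , 12 , d) = MarchToDecember⇒InG₀ y 12 d (≤ᵇ⇒≤ 3 12 _) (≤ᵇ⇒≤ 12 12 _)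
IsDate⇒InG₀ (y , 13 , d) v =
  (+ suc y , + 1 , + suc d) , (+≤+ (s≤s z≤n) , +≤+ (s≤s z≤n) , +≤+ (s≤s z≤n) , +≤+ v) ,
  refl , origin≤ y 13 d (≤ᵇ⇒≤ 3 13 _)
IsDate⇒InG₀ (y , 14 , d) v =
  (+ suc y , + 2 , + suc d) ,
  (+≤+ (s≤s z≤n) , +≤+ (s≤s (s≤s z≤n)) , +≤+ (s≤s z≤n) , subst (+ suc d ℤ.≤_) (sym (L-February y)) (+≤+ v)) ,
  refl , origin≤ y 14 d (≤ᵇ⇒≤ 3 14 _)
IsDate⇒InG₀ (y , 0 , d) ()
IsDate⇒InG₀ (y , 1 , d) ()
IsDate⇒InG₀ (y , 2 , d) ()
IsDate⇒InG₀ (y , 15+ k , d) ()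

<ₗ-irrefl : ∀ {z} → ¬ (z <ₗ z)
<ₗ-irrefl (inj₁ y<y)                   = ℤ.<-irrefl refl y<y
<ₗ-irrefl (inj₂ (inj₁ (_ , m<m)))      = ℤ.<-irrefl refl m<m
<ₗ-irrefl (inj₂ (inj₂ (_ , _ , d<d)))  = ℤ.<-irrefl refl d<d

<ₗ-irrelevant : ∀ {z z′} (p q : z <ₗ z′) → p ≡ q
<ₗ-irrelevant (inj₁ p) (inj₁ q) = cong inj₁ (ℤ.<-irrelevant p q)
<ₗ-irrelevant (inj₂ (inj₁ (refl , p))) (inj₂ (inj₁ (refl , q))) =
  cong (λ r → inj₂ (inj₁ (refl , r))) (ℤ.<-irrelevant p q)
<ₗ-irrelevant (inj₂ (inj₂ (refl , refl , p))) (inj₂ (inj₂ (refl , refl , q))) =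
  cong (λ r → inj₂ (inj₂ (refl , refl , r))) (ℤ.<-irrelevant p q)
<ₗ-irrelevant (inj₁ p) (inj₂ (inj₁ (refl , _)))                = ⊥-elim (ℤ.<-irrefl refl p)
<ₗ-irrelevant (inj₁ p) (inj₂ (inj₂ (refl , _)))                = ⊥-elim (ℤ.<-irrefl refl p)
<ₗ-irrelevant (inj₂ (inj₁ (refl , _))) (inj₁ q)                = ⊥-elim (ℤ.<-irrefl refl q)
<ₗ-irrelevant (inj₂ (inj₂ (refl , _))) (inj₁ q)                = ⊥-elim (ℤ.<-irrefl refl q)
<ₗ-irrelevant (inj₂ (inj₁ (refl , p))) (inj₂ (inj₂ (refl , refl , _))) = ⊥-elim (ℤ.<-irrefl refl p)
<ₗ-irrelevant (inj₂ (inj₂ (refl , refl , _))) (inj₂ (inj₁ (refl , q))) = ⊥-elim (ℤ.<-irrefl refl q)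

≤ₗ-irrelevant : ∀ {z z′} (p q : z ≤ₗ z′) → p ≡ q
≤ₗ-irrelevant (inj₁ p)    (inj₁ q)    = cong inj₁ (<ₗ-irrelevant p q)
≤ₗ-irrelevant (inj₁ p)    (inj₂ refl) = ⊥-elim (<ₗ-irrefl p)
≤ₗ-irrelevant (inj₂ refl) (inj₁ q)    = ⊥-elim (<ₗ-irrefl q)
≤ₗ-irrelevant (inj₂ refl) (inj₂ refl) = refl

InG-irrelevant : ∀ {x} (p q : InG x) → p ≡ q
InG-irrelevant (a , b , c , d) (a′ , b′ , c′ , d′)
  rewrite ℤ.≤-irrelevant a a′ | ℤ.≤-irrelevant b b′ | ℤ.≤-irrelevant c c′ | ℤ.≤-irrelevant d d′ = refl

InG₀-preimage-unique : ∀ {z} (p q : InG₀ z) → proj₁ p ≡ proj₁ q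
InG₀-preimage-unique p q with InG₀⇒view p | InG₀⇒view q
... | t , _ , t≡z , x≡ | t′ , _ , t′≡z , x′≡ =
  trans x≡ (trans (cong P₁⁻¹ (toℤ³-injective (trans t≡z (sym t′≡z)))) (sym x′≡))

InG₀-irrelevant : ∀ {z} (p q : InG₀ z) → p ≡ q
InG₀-irrelevant p@(x , x∈G , e , o≤) q@(_ , x∈G′ , e′ , o≤′) with InG₀-preimage-unique p q | e | e′
... | refl | refl | refl rewrite InG-irrelevant x∈G x∈G′ | ≤ₗ-irrelevant o≤ o≤′ = refl

G₀Interval-dayNumber : ∀ {a b} → G₀Interval a b → ℕ
G₀Interval-dayNumber (_ , z∈G₀ , _ , _) = dayNumber (proj₁ (InG₀⇒view z∈G₀))

view-date : ∀ {x t} (view : G₀View x (toℤ³ t)) → proj₁ view ≡ t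
view-date (_ , _ , t′≡t , _) = toℤ³-injective t′≡t

dayNumber-mono-≤ : ∀ {t t′} → IsDate t → toℤ³ t ≤ₗ toℤ³ t′ → dayNumber t ≤ dayNumber t′
dayNumber-mono-≤ {t} {t′} v (inj₁ t<t′) = <⇒≤ (dayNumber-mono t t′ v t<t′)
dayNumber-mono-≤ v (inj₂ t≡t′) = ≤-reflexive (cong dayNumber (toℤ³-injective t≡t′))

view-dayNumber-injective : ∀ {x x′ z z′} (view : G₀View x z) (view′ : G₀View x′ z′)
  → dayNumber (proj₁ view) ≡ dayNumber (proj₁ view′) → z ≡ z′
view-dayNumber-injective (t , v , refl , _) (t′ , v′ , refl , _) eq = cong toℤ³ (dayNumber-injective v v′ eq)

G₀Interval↔Fin : ∀ a b → IsDate a → IsDate b → Fin (dayNumber b ∸ dayNumber a) ↔ G₀Interval (toℤ³ a) (toℤ³ b)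
G₀Interval↔Fin a b a-valid b-valid = Fin↔-of-rank G₀Interval-dayNumber bounds injective surjective
  where
  view-bounds : ∀ {x z} (view : G₀View x z) → toℤ³ a ≤ₗ z → z <ₗ toℤ³ b
    → dayNumber a ≤ dayNumber (proj₁ view) × dayNumber (proj₁ view) < dayNumber b
  view-bounds (t , v , refl , _) a≤t t<b = dayNumber-mono-≤ a-valid a≤t , dayNumber-mono t b v t<b

  bounds : ∀ w → dayNumber a ≤ G₀Interval-dayNumber w × G₀Interval-dayNumber w < dayNumber b
  bounds (_ , z∈G₀ , a≤z , z<b) = view-bounds (InG₀⇒view z∈G₀) a≤z z<b

  injective : ∀ {w w′} → G₀Interval-dayNumber w ≡ G₀Interval-dayNumber w′ → w ≡ w′
  injective {_ , p , l , u} {_ , p′ , l′ , u′} eq with view-dayNumber-injective (InG₀⇒view p) (InG₀⇒view p′) eq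
  ... | refl rewrite InG₀-irrelevant p p′ | ≤ₗ-irrelevant l l′ | <ₗ-irrelevant u u′ = refl

  surjective : ∀ {n} → dayNumber a ≤ n → n < dayNumber b → Σ[ w ∈ G₀Interval (toℤ³ a) (toℤ³ b) ] G₀Interval-dayNumber w ≡ n
  surjective {n} a≤n n<b with dayNumber-surjective n
  ... | t , v , refl =
    (toℤ³ t , IsDate⇒InG₀ t v , dayNumber-reflects-≤ a-valid v a≤n , dayNumber-reflects-< v b-valid n<b) ,
    cong dayNumber (view-date (InG₀⇒view (IsDate⇒InG₀ t v)))

-- Years within a century

isLeap-nonCentennial : ∀ n → ¬ (n % 100 ≡ 0) → isLeap (+ n) ≡ (n % 4 ≡ᵇ 0)
isLeap-nonCentennial n n%100≢0 with n % 100 in n%100≡ | n % 400 in n%400≡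
... | zero  | _     = ⊥-elim (n%100≢0 refl)
... | suc _ | suc _ = trans (∨-identityʳ _) (∧-identityʳ _)
... | suc k | zero  = ⊥-elim (0≢1+n (begin
  0              ≡⟨ cong (_% 100) n%400≡ ⟨
  n % 400 % 100  ≡⟨ m∣n⇒o%n%m≡o%m 100 400 n (divides 4 refl) ⟩
  n % 100        ≡⟨ n%100≡ ⟩
  suc k          ∎))
  where open ≡-Reasoning

isLeap-inCentury : ∀ c i → i < 99 → isLeap (+ suc (c * 100 + i)) ≡ (suc i % 4 ≡ᵇ 0)
isLeap-inCentury c i i<99 = trans (isLeap-nonCentennial n (λ n%100≡0 → 0≢1+n (trans (sym n%100≡0) n%100))) (cong (_≡ᵇ 0) n%4)
  where
  n = suc (c * 100 + i)
  n%100 : n % 100 ≡ suc i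
  n%100 = trans (cong (λ x → suc x % 100) (+-comm (c * 100) i)) ([r+qn]%n≡r (suc i) c 100 (s≤s i<99))
  n%4 : n % 4 ≡ suc i % 4
  n%4 = trans (sym (m∣n⇒o%n%m≡o%m 4 100 n (divides 25 refl))) (cong (_% 4) n%100)

julianYearStart : ∀ {j} → j < 99 → 1461 * j / 4 + (337 + (if suc j % 4 ≡ᵇ 0 then 29 else 28)) ≡ 1461 * suc j / 4
julianYearStart = from-yes (allUpTo? (λ j → 1461 * j / 4 + (337 + (if suc j % 4 ≡ᵇ 0 then 29 else 28)) ≟ 1461 * suc j / 4) 99)

yearLength≤366 : ∀ y → yearLength y ≤ 366
yearLength≤366 y with isLeap (+ suc y)
... | true  = ≤-refl
... | false = n≤1+n 365

yearLength-inCentury : ∀ c j → j < 99 → yearLength (c * 100 + j) ≡ 337 + (if suc j % 4 ≡ᵇ 0 then 29 else 28)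
yearLength-inCentury c j j<99 rewrite isLeap-inCentury c j j<99 = refl

yearEnd-early : ∀ c j → j < 99 → 1461 * j / 4 + yearLength (c * 100 + j) ≡ 1461 * suc j / 4
yearEnd-early c j j<99 = trans (cong (_+_ (1461 * j / 4)) (yearLength-inCentury c j j<99)) (julianYearStart {j} j<99)

-- Whether year 99 is leap depends on the 400-year rule, and ⌊1461·100/4⌋ − ⌊1461·99/4⌋ = 366.
yearEnd-last : ∀ c → 1461 * 99 / 4 + yearLength (c * 100 + 99) ≤ 1461 * 100 / 4
yearEnd-last c = +-monoʳ-≤ (1461 * 99 / 4) {yearLength (c * 100 + 99)} {366} (yearLength≤366 (c * 100 + 99))

yearEnd-inCentury : ∀ c j → j < 100 → 1461 * j / 4 + yearLength (c * 100 + j) ≤ 1461 * suc j / 4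
yearEnd-inCentury c j j<100 =
  [ (λ j<99 → ≤-reflexive (yearEnd-early c j j<99))
  , (λ j≡99 → subst (λ k → 1461 * k / 4 + yearLength (c * 100 + k) ≤ 1461 * suc k / 4) (sym j≡99) (yearEnd-last c))
  ]′ (m≤n⇒m<n∨m≡n (s≤s⁻¹ j<100))

daysBeforeYear-inCentury : ∀ c j → j < 100 → daysBeforeYear (c * 100 + j) ≡ daysBeforeYear (c * 100) + 1461 * j / 4
daysBeforeYear-inCentury c zero _ = trans (cong daysBeforeYear (+-identityʳ (c * 100))) (sym (+-identityʳ (daysBeforeYear (c * 100))))
daysBeforeYear-inCentury c (suc j) j+1<100 = begin
  daysBeforeYear (c * 100 + suc j)                               ≡⟨ cong daysBeforeYear {c * 100 + suc j} {suc (c * 100 + j)} (+-suc (c * 100) j) ⟩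
  daysBeforeYear (suc (c * 100 + j))                             ≡⟨⟩
  daysBeforeYear (c * 100 + j) + yearLength (c * 100 + j)        ≡⟨ cong (_+ yearLength (c * 100 + j)) (daysBeforeYear-inCentury c j (<-trans (n<1+n j) j+1<100)) ⟩
  Y₀ + 1461 * j / 4 + yearLength (c * 100 + j)                   ≡⟨ +-assoc Y₀ (1461 * j / 4) (yearLength (c * 100 + j)) ⟩
  Y₀ + (1461 * j / 4 + yearLength (c * 100 + j))                 ≡⟨ cong (_+_ Y₀) (yearEnd-early c j (s≤s⁻¹ j+1<100)) ⟩
  Y₀ + 1461 * suc j / 4                                          ∎
  where
  open ≡-Reasoning
  Y₀ = daysBeforeYear (c * 100)

dayNumber-sinceYearStart : ∀ y₁ y m d k → daysBeforeYear y ≡ daysBeforeYear y₁ + k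
  → dayNumber (y , m , d) ∸ dayNumber (y₁ , 3 , 0) ≡ k + dayOfYear y m d
dayNumber-sinceYearStart y₁ y m d k y-start = begin
  daysBeforeYear y + r ∸ (Y₁ + 0)  ≡⟨ cong₂ _∸_ (cong (_+ r) y-start) (+-identityʳ Y₁) ⟩
  Y₁ + k + r ∸ Y₁                  ≡⟨ cong (_∸ Y₁) (+-assoc Y₁ k r) ⟩
  Y₁ + (k + r) ∸ Y₁                ≡⟨ m+n∸m≡n Y₁ (k + r) ⟩
  k + r                            ∎
  where
  open ≡-Reasoning
  Y₁ = daysBeforeYear y₁
  r = dayOfYear y m d

yearAndDay-ofCentury : ∀ Y m d → IsDate (Y , m , d) → ∀ r₁
  → Fin r₁ ↔ G₀Interval (toℤ³ (Y / 100 * 100 , 3 , 0)) (toℤ³ (Y , m , d))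
  → (4 * r₁ + 3) / 1461 ≡ Y % 100
  × Fin ((4 * r₁ + 3) % 1461 / 4) ↔ G₀Interval (toℤ³ (Y , 3 , 0)) (toℤ³ (Y , m , d))
yearAndDay-ofCentury Y m d v r₁ century↔ =
  subst (λ n → (4 * n + 3) / 1461 ≡ j × Fin ((4 * n + 3) % 1461 / 4) ↔ G₀Interval (toℤ³ (Y , 3 , 0)) (toℤ³ (Y , m , d)))
    (sym r₁≡) (proj₁ inverse , subst (λ k → Fin k ↔ G₀Interval (toℤ³ (Y , 3 , 0)) (toℤ³ (Y , m , d))) (sym (proj₂ inverse)) year↔)
  where
  c = Y / 100
  j = Y % 100
  r = dayOfYear Y m d

  j<100 : j < 100
  j<100 = m%n<n Y 100

  Y≡ : Y ≡ c * 100 + j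
  Y≡ = trans (m≡m%n+[m/n]*n Y 100) (+-comm j (c * 100))

  r₁≡ : r₁ ≡ 1461 * j / 4 + r
  r₁≡ = trans (↔⇒≡ (↔-trans century↔ (↔-sym (G₀Interval↔Fin (c * 100 , 3 , 0) (Y , m , d) (s≤s z≤n) v))))
    (dayNumber-sinceYearStart (c * 100) Y m d (1461 * j / 4) (trans (cong daysBeforeYear Y≡) (daysBeforeYear-inCentury c j j<100)))

  below-next : 1461 * j / 4 + r < 1461 * suc j / 4
  below-next = begin-strict
    1461 * j / 4 + r                         <⟨ +-monoʳ-< (1461 * j / 4) (dayOfYear<yearLength {Y} {m} {d} v) ⟩
    1461 * j / 4 + yearLength Y              ≡⟨ cong (λ y → 1461 * j / 4 + yearLength y) {Y} {c * 100 + j} Y≡ ⟩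
    1461 * j / 4 + yearLength (c * 100 + j)  ≤⟨ yearEnd-inCentury c j j<100 ⟩
    1461 * suc j / 4                         ∎
    where open ≤-Reasoning

  inverse = floor-affine-inverse 1461 4 j r below-next

  year↔ : Fin r ↔ G₀Interval (toℤ³ (Y , 3 , 0)) (toℤ³ (Y , m , d))
  year↔ = subst (λ k → Fin k ↔ G₀Interval (toℤ³ (Y , 3 , 0)) (toℤ³ (Y , m , d)))
    (dayNumber-sinceYearStart Y Y m d 0 (sym (+-identityʳ (daysBeforeYear Y))))
    (G₀Interval↔Fin (Y , 3 , 0) (Y , m , d) (s≤s z≤n) v)

proposition3 : (y₀ m₀ d₀ : ℤ) → InG₀ (y₀ , m₀ , d₀) → (r₁ : ℕ)
    → Fin r₁ ↔ G₀Interval (+ 100 *ℤ (y₀ /ℕ 100) , + 3 , + 0) (y₀ , m₀ , d₀)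
    → ((4 * r₁ + 3) / 1461 ≡ y₀ %ℕ 100)
    × (Fin ((4 * r₁ + 3) % 1461 / 4) ↔ G₀Interval (y₀ , + 3 , + 0) (y₀ , m₀ , d₀))
proposition3 y₀ m₀ d₀ x₀∈G₀ r₁ century↔ with InG₀⇒view x₀∈G₀
... | (Y , m , d) , v , refl , _ = yearAndDay-ofCentury Y m d v r₁ (subst (λ y → Fin r₁ ↔ G₀Interval (y , + 3 , + 0) (+ Y , + m , + d)) centuryStart century↔)
  where
  centuryStart : + 100 *ℤ (+ Y /ℕ 100) ≡ + (Y / 100 * 100)
  centuryStart = trans (sym (ℤ.pos-* 100 (Y / 100))) (cong +_ (*-comm 100 (Y / 100)))
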